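{- Let $\mathcal{B}$ be the class of all bipartite graphs and $\mathcal{K}=\{K_n:n\in\mathbb{N}\}$ the class of all complete graphs. Then $\sup_{K\in\mathcal{K}}c^{\mathcal{B}}_{\mathrm l}(K)=\infty$ and $\sup_{K\in\mathcal{K}}c^{\mathcal{B}}_{\mathrm f}(K)\le 2$. In particular, there is a monotone graph class $\mathcal{G}$ with bounded chromatic number and a class $\mathcal{H}$ that is not $(c^{\mathcal{G}}_{\mathrm l},c^{\mathcal{G}}_{\mathrm f})$-bounded.
   Context: All graphs are finite and simple. A class is monotone if closed under subgraphs. For graphs $G,H$, a homomorphism $\varphi\colon G\to H$ is a map $V(G)\to V(H)$ with $\varphi(u)\varphi(v)\in E(H)$ whenever $uv\in E(G)$. $\dot\cup$ denotes vertex-disjoint union. For a graph class $\mathcal{G}$ and a graph $H$, a $\mathcal{G}$-cover of $H$ is an edge-surjective homomorphism $\varphi\colon G_1\dot\cup\cdots\dot\cup G_t\to H$ with all $G_i\in\mathcal{G}$; it is injective if each $\varphi|_{G_i}$ is injective, and $s$-local if $|\varphi^{ -1}(v)|\le s$ for all $v\in V(H)$. $c^{\mathcal{G}}_{\mathrm l}(H)$ is the least $s$ such that $H$ has an $s$-local injective $\mathcal{G}$-cover; $c^{\mathcal{G}}_{\mathrm f}(H)$ the least $s$ such that $H$ has an $s$-local (not necessarily injective) $\mathcal{G}$-cover. $\mathcal{H}$ is $(c^{\mathcal{G}}_{\mathrm l},c^{\mathcal{G}}_{\mathrm f})$-bounded if there is $f\colon\mathbb{N}\to\mathbb{R}_{\ge0}$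 with $c^{\mathcal{G}}_{\mathrm f}(H)\le c^{\mathcal{G}}_{\mathrm l}(H)\le f(c^{\mathcal{G}}_{\mathrm f}(H))$ for all $H\in\mathcal{H}$. -}

module Defs where

open import Data.Nat using (ℕ; zero; suc; _+_; _≤_; _<_)
open import Data.Fin using (Fin; zero; suc; _≟_)
open import Data.Bool using (Bool; true; false)
open import Data.Product using (Σ; ∃; _×_; _,_)
open import Relation.Nullary using (¬_; does)
open import Relation.Binary.PropositionalEquality using (_≡_; _≢_; sym; refl)
open import Function.Definitions using (Injective)

record Graph : Set₁ where
  field
    size   : ℕ
    E      : Fin size → Fin size → Set
    E-sym  : ∀ {u v} → E u v → E v u
    E-irr  : ∀ {u} → ¬ E u u
open Graph public

-- A graph class (isomorphism closure is implied by monotonicity below).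
Class : Set₁
Class = Graph → Set

IsHom : (G H : Graph) → (Fin (size G) → Fin (size H)) → Set
IsHom G H φ = ∀ {u v} → E G u v → E H (φ u) (φ v)

Subgraph : Graph → Graph → Set
Subgraph H G = Σ (Fin (size H) → Fin (size G)) λ φ →
  IsHom H G φ × Injective _≡_ _≡_ φ

Monotone : Class → Set₁
Monotone 𝒢 = ∀ (G H : Graph) → Subgraph H G → 𝒢 G → 𝒢 H

Colourable : ℕ → Graph → Set
Colourable k G = Σ (Fin (size G) → Fin k) λ c → ∀ {u v} → E G u v → c u ≢ c v

BoundedChromatic : Class → Set₁
BoundedChromatic 𝒢 = Σ ℕ λ k → ∀ G → 𝒢 G → Colourable k G

Bipartite : Class
Bipartite = Colourable 2

K : ℕ → Graph
K n = record { size = n ; E = λ u v → u ≢ v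
             ; E-sym = λ p q → p (sym q) ; E-irr = λ p → p refl }

sumFin : (n : ℕ) → (Fin n → ℕ) → ℕ
sumFin zero f = 0
sumFin (suc n) f = f zero + sumFin n (λ i → f (suc i))

countFin : (n : ℕ) → (Fin n → Bool) → ℕ
countFin n p = sumFin n (λ i → b2n (p i))
  where
  b2n : Bool → ℕ
  b2n true = 1
  b2n false = 0

-- A 𝒢-cover of H: homomorphism from G_1 ∪̇ ... ∪̇ G_t (all in 𝒢) to H,
-- surjective on edges.
record Cover (𝒢 : Class) (H : Graph) : Set₁ where
  field
    t     : ℕ
    part  : Fin t → Graph
    inG   : ∀ i → 𝒢 (part i)
    φ     : ∀ i → Fin (size (part i)) → Fin (size H)
    hom   : ∀ i → IsHom (part i) H (φ i)
    surj  : ∀ {x y} → E H x y →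
            Σ (Fin t) λ i → Σ (Fin (size (part i))) λ u → Σ (Fin (size (part i))) λ v →
              E (part i) u v × φ i u ≡ x × φ i v ≡ y

  preimages : Fin (size H) → ℕ
  preimages v = sumFin t λ i → countFin (size (part i)) λ u → does (φ i u ≟ v)

  IsInjective : Set
  IsInjective = ∀ i → Injective _≡_ _≡_ (φ i)

  IsLocal : ℕ → Set
  IsLocal s = ∀ v → preimages v ≤ s
open Cover public

HasLocalCover : Class → ℕ → Graph → Set₁
HasLocalCover 𝒢 s H = Σ (Cover 𝒢 H) λ C → IsLocal C s

HasLocalInjCover : Class → ℕ → Graph → Set₁
HasLocalInjCover 𝒢 s H = Σ (Cover 𝒢 H) λ C → IsInjective C × IsLocal C s

IsCl : Class → Graph → ℕ → Set₁
IsCl 𝒢 H s = HasLocalInjCover 𝒢 s H × (∀ s' → s' < s → ¬ HasLocalInjCover 𝒢 s' H)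

IsCf : Class → Graph → ℕ → Set₁
IsCf 𝒢 H s = HasLocalCover 𝒢 s H × (∀ s' → s' < s → ¬ HasLocalCover 𝒢 s' H)

LFBounded : Class → Class → Set₁
LFBounded 𝒢 ℋ = Σ (ℕ → ℕ) λ f → ∀ H → ℋ H → ∀ a b → IsCl 𝒢 H a → IsCf 𝒢 H b →
  b ≤ a × a ≤ f b

-- Every graph H has a 2-local bipartite cover: the projection of its bipartite double cover
-- H × K₂. Conversely, an injective s-local bipartite cover of H records each vertex x as the
-- list of pairs (i , c) such that x has a preimage of colour c in part i. Injectivity makes
-- this list a partial 2-colouring of the parts with at most s entries, and an edge xy forces
-- the lists of x and y to give some part opposite colours. For Kₙ the n lists therefore
-- pairwise conflict, and such a family has at most conflictBound s members: fix one list p;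
-- every other list clashes with some entry e of p, the lists clashing with e agree at the
-- index of e, and forgetting that index leaves a pairwise conflicting family of shorter lists.
module Submission where

open import Defs
open import Data.Nat using (ℕ; zero; suc; _+_; _*_; _≤_; _<_; z≤n; s≤s)
open import Data.Nat.Properties
  using (≤-refl; ≤-trans; ≤-reflexive; ≤-pred; <-≤-trans; n≮n; ≮⇒≥; +-mono-≤; *-monoˡ-≤;
         m≤m+n; m≤n+m; *-identityʳ; +-commutativeSemigroup; module ≤-Reasoning)
open import Data.Nat.ListAction using (sum)
open import Data.Nat.Induction using (<-wellFounded)
open import Algebra.Properties.CommutativeSemigroup +-commutativeSemigroup using (interchange)
open import Data.Bool using (if_then_else_)
open import Data.Empty using (⊥; ⊥-elim)
open import Data.Fin using (Fin; zero; suc; toℕ; opposite; splitAt; _↑ˡ_; _↑ʳ_; _≟_)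
open import Data.Fin.Properties using (0≢1+n; suc-injective; splitAt-↑ˡ; splitAt-↑ʳ)
open import Data.Sum using (_⊎_; inj₁; inj₂; map₁; reduce; swap)
open import Data.Product using (Σ; ∃; _×_; _,_; proj₁; proj₂)
open import Data.Product.Properties using (≡-dec)
open import Data.List using (List; []; _∷_; [_]; length; filter; map; tabulate; concat; allFin)
open import Data.List.Properties
  using (length-++; length-map; length-tabulate; filter-++; filter-accept; filter-notAll; map-cong)
open import Data.List.Relation.Unary.All as All using (All; []; _∷_)
import Data.List.Relation.Unary.All.Properties as All
open import Data.List.Relation.Unary.Any as Any using (Any; here; there)
open import Data.List.Relation.Unary.AllPairs using (AllPairs; []; _∷_)
import Data.List.Relation.Unary.AllPairs.Properties as AllPairs
open import Data.List.Membership.Propositional using (_∈_; find; lose)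
open import Data.List.Membership.Propositional.Properties
  using (∈-filter⁺; ∈-filter⁻; ∈-map⁺; ∈-map⁻; ∈-tabulate⁺; ∈-tabulate⁻; ∈-concat⁺′; ∈-concat⁻′;
         ∈-allFin)
open import Function using (id; _∘_)
open import Function.Definitions using (Injective)
open import Induction.WellFounded using (Acc; acc)
open import Relation.Nullary using (¬_; yes; no; does; ¬?)
open import Relation.Nullary.Decidable using (dec-true; dec-false)
open import Relation.Unary using (Decidable)
open import Relation.Binary.Definitions using (DecidableEquality)
open import Relation.Binary.PropositionalEquality
  using (_≡_; _≢_; refl; sym; trans; cong; cong₂; subst; subst₂; ≢-sym)

private variable A B : Set

sumFin-cong : ∀ n {f g : Fin n → ℕ} → (∀ i → f i ≡ g i) → sumFin n f ≡ sumFin n g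
sumFin-cong zero    _   = refl
sumFin-cong (suc n) f≗g = cong₂ _+_ (f≗g zero) (sumFin-cong n (f≗g ∘ suc))

sumFin-≤ : ∀ n {f : Fin n → ℕ} {b} → (∀ i → f i ≤ b) → sumFin n f ≤ n * b
sumFin-≤ zero    _   = z≤n
sumFin-≤ (suc n) f≤b = +-mono-≤ (f≤b zero) (sumFin-≤ n (f≤b ∘ suc))

≤-sumFin : ∀ k (f : ℕ → ℕ) {b} → b < k → f b ≤ sumFin k (f ∘ toℕ)
≤-sumFin (suc k) f {zero}  _         = m≤m+n (f 0) _
≤-sumFin (suc k) f {suc b} (s≤s b<k) = ≤-trans (≤-sumFin k (f ∘ suc) b<k) (m≤n+m _ (f 0))

sum-map-+ : ∀ (f g : A → ℕ) as → sum (map (λ a → f a + g a) as) ≡ sum (map f as) + sum (map g as)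
sum-map-+ f g []       = refl
sum-map-+ f g (a ∷ as) = trans (cong (f a + g a +_) (sum-map-+ f g as)) (interchange (f a) (g a) _ _)

sum-map-≤ : ∀ {f : A → ℕ} {b} as → (∀ a → f a ≤ b) → sum (map f as) ≤ length as * b
sum-map-≤ []       _   = z≤n
sum-map-≤ (a ∷ as) f≤b = +-mono-≤ (f≤b a) (sum-map-≤ as f≤b)

length-filter-∷ : ∀ {P : B → Set} (P? : Decidable P) b bs →
  length (filter P? (b ∷ bs)) ≡ length (filter P? [ b ]) + length (filter P? bs)
length-filter-∷ P? b bs = trans (cong length (filter-++ P? [ b ] bs)) (length-++ (filter P? [ b ]))

length-≤-sum-filter : ∀ {P : A → B → Set} (P? : ∀ a → Decidable (P a)) as bs →
  All (λ b → Any (λ a → P a b) as) bs → length bs ≤ sum (map (λ a → length (filter (P? a) bs)) as)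
length-≤-sum-filter P? as []       _ = z≤n
length-≤-sum-filter {A = A} {B = B} {P = P} P? as (b ∷ bs) (hit ∷ hits) = begin
  1 + length bs
    ≤⟨ +-mono-≤ (hit-counted as hit) (length-≤-sum-filter P? as bs hits) ⟩
  sum (map (count [ b ]) as) + sum (map (count bs) as)
    ≡⟨ sum-map-+ (count [ b ]) (count bs) as ⟨
  sum (map (λ a → count [ b ] a + count bs a) as)
    ≡⟨ cong sum (map-cong (λ a → length-filter-∷ (P? a) b bs) as) ⟨
  sum (map (count (b ∷ bs)) as) ∎
  where
  open ≤-Reasoning
  count : List B → A → ℕ
  count bs a = length (filter (P? a) bs)
  hit-counted : ∀ as → Any (λ a → P a b) as → 1 ≤ sum (map (count [ b ]) as)
  hit-counted (a ∷ as) (here pab)  rewrite filter-accept (P? a) {xs = []} pab = s≤s z≤n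
  hit-counted (a ∷ as) (there hit) = ≤-trans (hit-counted as hit) (m≤n+m _ _)

length-concat-tabulate : ∀ n (g : Fin n → List A) → length (concat (tabulate g)) ≡ sumFin n (length ∘ g)
length-concat-tabulate zero    g = refl
length-concat-tabulate (suc n) g =
  trans (length-++ (g zero)) (cong (length (g zero) +_) (length-concat-tabulate n (g ∘ suc)))

AllPairs-map-All : ∀ {P : A → Set} {R S : A → A → Set} → (∀ {x y} → P x → P y → R x y → S x y) →
  ∀ {xs} → All P xs → AllPairs R xs → AllPairs S xs
AllPairs-map-All f []         []         = []
AllPairs-map-All f (px ∷ pxs) (rx ∷ rxs) =
  All.zipWith (λ (py , r) → f px py r) (pxs , rx) ∷ AllPairs-map-All f pxs rxs

fibre : ∀ {m n} → (Fin m → Fin n) → Fin n → List (Fin m)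
fibre f v = filter (λ u → f u ≟ v) (allFin _)

∈-fibre⁺ : ∀ {m n} {f : Fin m → Fin n} {u v} → f u ≡ v → u ∈ fibre f v
∈-fibre⁺ {f = f} {u} {v} = ∈-filter⁺ (λ w → f w ≟ v) (∈-allFin u)

∈-fibre⁻ : ∀ {m n} {f : Fin m → Fin n} {u v} → u ∈ fibre f v → f u ≡ v
∈-fibre⁻ {f = f} {v = v} = proj₂ ∘ ∈-filter⁻ (λ w → f w ≟ v) {xs = allFin _}

fibreSize : ∀ {m n} → (Fin m → Fin n) → Fin n → ℕ
fibreSize {m} f v = countFin m (λ u → does (f u ≟ v))

length-fibre : ∀ {m n} (f : Fin m → Fin n) v → length (fibre f v) ≡ fibreSize f v
length-fibre f v = go _ id
  where
  go : ∀ k (g : Fin k → _) →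
       length (filter (λ u → f u ≟ v) (tabulate g)) ≡ countFin k (λ u → does (f (g u) ≟ v))
  go zero    g = refl
  go (suc k) g with f (g zero) ≟ v
  ... | yes _ = cong suc (go k (g ∘ suc))
  ... | no  _ = go k (g ∘ suc)

fibreSize-∅ : ∀ {m n} (f : Fin m → Fin n) {v} → (∀ u → f u ≢ v) → fibreSize f v ≡ 0
fibreSize-∅ {zero}  f _   = refl
fibreSize-∅ {suc m} f {v} f≢v with f zero ≟ v
... | yes f0≡v = ⊥-elim (f≢v zero f0≡v)
... | no  _    = fibreSize-∅ (f ∘ suc) (f≢v ∘ suc)

fibreSize-injective : ∀ {m n} {f : Fin m → Fin n} → Injective _≡_ _≡_ f → ∀ v → fibreSize f v ≤ 1
fibreSize-injective {zero}          _     _ = z≤n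
fibreSize-injective {suc m} {f = f} f-inj v with f zero ≟ v
... | yes f0≡v = ≤-reflexive (cong suc (fibreSize-∅ (f ∘ suc) λ u fu≡v →
                   0≢1+n (f-inj (trans f0≡v (sym fu≡v)))))
... | no  _    = fibreSize-injective (suc-injective ∘ f-inj) v

fibreSize-splitAt : ∀ m {k n} (g : Fin m ⊎ Fin k → Fin n) v →
  fibreSize (g ∘ splitAt m) v ≡ fibreSize (g ∘ inj₁) v + fibreSize (g ∘ inj₂) v
fibreSize-splitAt zero    g v = refl
fibreSize-splitAt (suc m) g v with g (inj₁ zero) ≟ v
... | yes _ = cong suc (fibreSize-splitAt m (g ∘ map₁ suc) v)
... | no  _ = fibreSize-splitAt m (g ∘ map₁ suc) v

IsLocal-mono : ∀ {𝒢 H s s'} (C : Cover 𝒢 H) → s ≤ s' → IsLocal C s → IsLocal C s'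
IsLocal-mono C s≤s' local v = ≤-trans (local v) s≤s'

HasLocalInjCover-mono : ∀ {𝒢 H s s'} → s ≤ s' → HasLocalInjCover 𝒢 s H → HasLocalInjCover 𝒢 s' H
HasLocalInjCover-mono s≤s' (C , inj , local) = C , inj , IsLocal-mono C s≤s' local

fibreSize-≤⇒IsLocal : ∀ {𝒢 H k} (C : Cover 𝒢 H) → (∀ i v → fibreSize (φ C i) v ≤ k) →
                      IsLocal C (t C * k)
fibreSize-≤⇒IsLocal C fibre≤k v = sumFin-≤ (t C) (λ i → fibre≤k i v)

Colourable-monotone : ∀ k → Monotone (Colourable k)
Colourable-monotone k G H (ψ , ψ-hom , _) (c , c-proper) = c ∘ ψ , c-proper ∘ ψ-hom

-- The bipartite double cover

DoubleEdge : ∀ {m} → (Fin m → Fin m → Set) → Fin m ⊎ Fin m → Fin m ⊎ Fin m → Set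
DoubleEdge E (inj₁ x) (inj₂ y) = E x y
DoubleEdge E (inj₂ x) (inj₁ y) = E x y
DoubleEdge E _        _        = ⊥

module _ (H : Graph) where

  DoubleEdge-sym : ∀ a b → DoubleEdge (E H) a b → DoubleEdge (E H) b a
  DoubleEdge-sym (inj₁ x) (inj₂ y) xy = E-sym H xy
  DoubleEdge-sym (inj₂ x) (inj₁ y) xy = E-sym H xy

  DoubleEdge-irrefl : ∀ a → ¬ DoubleEdge (E H) a a
  DoubleEdge-irrefl (inj₁ x) ()
  DoubleEdge-irrefl (inj₂ x) ()

  DoubleEdge-reduce : ∀ a b → DoubleEdge (E H) a b → E H (reduce a) (reduce b)
  DoubleEdge-reduce (inj₁ x) (inj₂ y) xy = xy
  DoubleEdge-reduce (inj₂ x) (inj₁ y) xy = xy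

side : ∀ {m} → Fin m ⊎ Fin m → Fin 2
side (inj₁ _) = zero
side (inj₂ _) = suc zero

DoubleEdge-side : ∀ {m} {E : Fin m → Fin m → Set} a b → DoubleEdge E a b → side a ≢ side b
DoubleEdge-side (inj₁ x) (inj₂ y) _ ()
DoubleEdge-side (inj₂ x) (inj₁ y) _ ()

bipartiteDouble : Graph → Graph
bipartiteDouble H = record
  { size  = m + m
  ; E     = λ u v → DoubleEdge (E H) (splitAt m u) (splitAt m v)
  ; E-sym = λ {u} {v} → DoubleEdge-sym H (splitAt m u) (splitAt m v)
  ; E-irr = λ {u} → DoubleEdge-irrefl H (splitAt m u)
  }
  where m = size H

doubleCover : (H : Graph) → Cover Bipartite H
doubleCover H = record
  { t    = 1
  ; part = λ _ → bipartiteDouble H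
  ; inG  = λ _ → side ∘ splitAt m , λ {u} {v} → DoubleEdge-side (splitAt m u) (splitAt m v)
  ; φ    = λ _ → reduce ∘ splitAt m
  ; hom  = λ _ {u} {v} → DoubleEdge-reduce H (splitAt m u) (splitAt m v)
  ; surj = λ {x} {y} xy → zero , x ↑ˡ m , m ↑ʳ y
         , subst₂ (DoubleEdge (E H)) (sym (splitAt-↑ˡ m x m)) (sym (splitAt-↑ʳ m m y)) xy
         , cong reduce (splitAt-↑ˡ m x m) , cong reduce (splitAt-↑ʳ m m y)
  }
  where m = size H

doubleCover-2-local : (H : Graph) → HasLocalCover Bipartite 2 H
doubleCover-2-local H = doubleCover H , fibreSize-≤⇒IsLocal (doubleCover H) λ _ v →
  ≤-trans (≤-reflexive (fibreSize-splitAt (size H) reduce v))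
          (+-mono-≤ (fibreSize-injective id v) (fibreSize-injective id v))

-- The cover by stars

star : (H : Graph) → Fin (size H) → Graph
star H x = record
  { size  = size H
  ; E     = λ u v → E H u v × (u ≡ x ⊎ v ≡ x)
  ; E-sym = λ (uv , incident) → E-sym H uv , swap incident
  ; E-irr = λ (uu , _) → E-irr H uu
  }

starColour : ∀ {m} → Fin m → Fin m → Fin 2
starColour x u = if does (u ≟ x) then zero else suc zero

starColour-proper : ∀ H x {u v} → E (star H x) u v → starColour x u ≢ starColour x v
starColour-proper H x {v = v} (xv , inj₁ refl)
  rewrite dec-true (x ≟ x) refl | dec-false (v ≟ x) (λ v≡x → E-irr H (subst (E H x) v≡x xv)) = λ ()
starColour-proper H x (uv , inj₂ refl) = ≢-sym (starColour-proper H x (E-sym H uv , inj₁ refl))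

starCover : (H : Graph) → Cover Bipartite H
starCover H = record
  { t    = size H
  ; part = star H
  ; inG  = λ x → starColour x , starColour-proper H x
  ; φ    = λ _ → id
  ; hom  = λ _ → proj₁
  ; surj = λ {x} {y} xy → x , x , y , (xy , inj₁ refl) , refl , refl
  }

starCover-local : (H : Graph) → HasLocalInjCover Bipartite (size H) H
starCover-local H = starCover H , (λ _ → id) ,
  IsLocal-mono (starCover H) (≤-reflexive (*-identityʳ (size H)))
    (fibreSize-≤⇒IsLocal (starCover H) λ _ → fibreSize-injective id)

-- Pairwise conflicting partial 2-colourings

opposite-≢ : ∀ (c : Fin 2) → opposite c ≢ c
opposite-≢ zero       ()
opposite-≢ (suc zero) ()

≢⇒≡opposite : ∀ {c c' : Fin 2} → c ≢ c' → c' ≡ opposite c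
≢⇒≡opposite {zero}     {zero}     c≢c' = ⊥-elim (c≢c' refl)
≢⇒≡opposite {zero}     {suc zero} _    = refl
≢⇒≡opposite {suc zero} {zero}     _    = refl
≢⇒≡opposite {suc zero} {suc zero} c≢c' = ⊥-elim (c≢c' refl)

conflictBound : ℕ → ℕ
conflictBound zero    = 1
conflictBound (suc s) = suc (suc s * conflictBound s)

-- A Functional list of entries (i , c) is a partial 2-colouring of I.
module PartialColouring {I : Set} (_≟ᵢ_ : DecidableEquality I) where

  Entry : Set
  Entry = I × Fin 2

  Functional : List Entry → Set
  Functional p = ∀ {i c c'} → (i , c) ∈ p → (i , c') ∈ p → c ≡ c'

  Admissible : ℕ → List Entry → Set
  Admissible s p = Functional p × length p ≤ s

  Clashes : Entry → List Entry → Set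
  Clashes e q = (proj₁ e , opposite (proj₂ e)) ∈ q

  Clashes? : ∀ e → Decidable (Clashes e)
  Clashes? e q = (proj₁ e , opposite (proj₂ e)) ∈? q
    where open import Data.List.Membership.DecPropositional (≡-dec _≟ᵢ_ _≟_) using (_∈?_)

  Conflict : List Entry → List Entry → Set
  Conflict p q = Any (λ e → Clashes e q) p

  forget : I → List Entry → List Entry
  forget i = filter (λ e → ¬? (proj₁ e ≟ᵢ i))

  forget-admissible : ∀ {s e q} → Clashes e q → Admissible (suc s) q →
                      Admissible s (forget (proj₁ e) q)
  forget-admissible {q = q} clash (q-fun , |q|≤) =
    (λ ic∈ ic'∈ → q-fun (proj₁ (∈-filter⁻ _ ic∈)) (proj₁ (∈-filter⁻ _ ic'∈))) ,
    ≤-pred (<-≤-trans (filter-notAll _ q (Any.map (λ { refl ≢i → ≢i refl }) clash)) |q|≤)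

  forget-conflict : ∀ {e q r} → Clashes e q → Clashes e r → Functional q → Functional r →
                    Conflict q r → Conflict (forget (proj₁ e) q) (forget (proj₁ e) r)
  forget-conflict {i , c} q-clash r-clash q-fun r-fun q~r with find q~r
  ... | (j , d) , jd∈q , jd'∈r with j ≟ᵢ i
  ...   | no  j≢i  = lose (∈-filter⁺ _ jd∈q j≢i) (∈-filter⁺ _ jd'∈r j≢i)
  ...   | yes refl = ⊥-elim (opposite-≢ (opposite c)
                       (trans (cong opposite (sym (q-fun jd∈q q-clash))) (r-fun jd'∈r r-clash)))

  conflicting-≤ : ∀ s {W} → All (Admissible s) W → AllPairs Conflict W → length W ≤ conflictBound s
  conflicting-≤ s       {[]}          []             _              = z≤n
  conflicting-≤ zero    {_ ∷ []}      _              _              = ≤-refl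
  conflicting-≤ zero    {[] ∷ _ ∷ _}  _              ((() ∷ _) ∷ _)
  conflicting-≤ zero    {(_ ∷ _) ∷ _} ((_ , ()) ∷ _) _
  conflicting-≤ (suc s) {p ∷ W} ((_ , |p|≤) ∷ adm) (p~W ∷ pairs) = s≤s (begin
    length W                                            ≤⟨ length-≤-sum-filter Clashes? p W p~W ⟩
    sum (map (λ e → length (filter (Clashes? e) W)) p)  ≤⟨ sum-map-≤ p group-≤ ⟩
    length p * conflictBound s                          ≤⟨ *-monoˡ-≤ (conflictBound s) |p|≤ ⟩
    suc s * conflictBound s                             ∎)
    where
    open ≤-Reasoning
    group-≤ : ∀ e → length (filter (Clashes? e) W) ≤ conflictBound s
    group-≤ e = ≤-trans (≤-reflexive (sym (length-map (forget (proj₁ e)) (filter (Clashes? e) W))))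
      (conflicting-≤ s
        (All.map⁺ (All.map (λ (clash , q-adm) → forget-admissible {e = e} clash q-adm) group))
        (AllPairs.map⁺ (AllPairs-map-All
          (λ (q-clash , q-fun , _) (r-clash , r-fun , _) → forget-conflict {e} q-clash r-clash q-fun r-fun)
          group (AllPairs.filter⁺ (Clashes? e) pairs))))
      where
      group : All (λ q → Clashes e q × Admissible (suc s) q) (filter (Clashes? e) W)
      group = All.zip (All.all-filter (Clashes? e) W , All.filter⁺ (Clashes? e) adm)

-- Partial colourings from an injective bipartite cover

module _ {H : Graph} (C : Cover Bipartite H) where
  open PartialColouring (_≟_ {t C})

  colour : ∀ i → Fin (size (part C i)) → Fin 2
  colour i = proj₁ (inG C i)

  entriesIn : Fin (size H) → Fin (t C) → List Entry
  entriesIn x i = map (λ u → i , colour i u) (fibre (φ C i) x)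

  entries : Fin (size H) → List Entry
  entries x = concat (tabulate (entriesIn x))

  length-entries : ∀ x → length (entries x) ≡ preimages C x
  length-entries x = trans (length-concat-tabulate (t C) _) (sumFin-cong (t C) λ i →
    trans (length-map _ (fibre (φ C i) x)) (length-fibre (φ C i) x))

  ∈-entries⁺ : ∀ {i u x} → φ C i u ≡ x → (i , colour i u) ∈ entries x
  ∈-entries⁺ {i} φu≡x = ∈-concat⁺′ (∈-map⁺ _ (∈-fibre⁺ φu≡x)) (∈-tabulate⁺ i)

  ∈-entries⁻ : ∀ {i c x} → (i , c) ∈ entries x → ∃ λ u → φ C i u ≡ x × colour i u ≡ c
  ∈-entries⁻ {x = x} ic∈ with ∈-concat⁻′ _ ic∈
  ... | _ , ic∈l , l∈ with ∈-tabulate⁻ {f = entriesIn x} l∈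
  ... | _ , refl with ∈-map⁻ _ ic∈l
  ... | u , u∈fibre , refl = u , ∈-fibre⁻ u∈fibre , refl

  entries-functional : IsInjective C → ∀ x → Functional (entries x)
  entries-functional inj x ic∈ ic'∈ with ∈-entries⁻ ic∈ | ∈-entries⁻ ic'∈
  ... | u , φu≡x , refl | u' , φu'≡x , refl = cong (colour _) (inj _ (trans φu≡x (sym φu'≡x)))

  entries-conflict : ∀ {x y} → E H x y → Conflict (entries x) (entries y)
  entries-conflict xy with surj C xy
  ... | i , u , v , uv , refl , refl =
    lose (∈-entries⁺ refl) (subst (λ c → (i , c) ∈ entries (φ C i v))
                                  (≢⇒≡opposite (proj₂ (inG C i) uv)) (∈-entries⁺ refl))

no-injective-local-cover : ∀ s → ¬ HasLocalInjCover Bipartite s (K (suc (conflictBound s)))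
no-injective-local-cover s (C , inj , local) = n≮n (conflictBound s) (begin
  suc (conflictBound s)         ≡⟨ length-tabulate (entries C) ⟨
  length (tabulate (entries C)) ≤⟨ conflicting-≤ s admissible pairwise ⟩
  conflictBound s               ∎)
  where
  open ≤-Reasoning
  open PartialColouring (_≟_ {t C})
  admissible : All (Admissible s) (tabulate (entries C))
  admissible = All.tabulate⁺ λ x →
    entries-functional C inj x , ≤-trans (≤-reflexive (length-entries C x)) (local x)
  pairwise : AllPairs Conflict (tabulate (entries C))
  pairwise = AllPairs.tabulate⁺ (entries-conflict C)

Least : ∀ {ℓ} → (ℕ → Set ℓ) → ℕ → Set ℓ
Least P a = P a × (∀ a' → a' < a → ¬ P a')

-- Having a local cover is undecidable here, so a least witness only exists doubly negated.
¬¬-least : ∀ {ℓ} (P : ℕ → Set ℓ) {m} → P m → ¬ ¬ ∃ (Least P)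
¬¬-least P {m} pm no-least = go m (<-wellFounded m) pm
  where
  go : ∀ a → Acc _<_ a → ¬ P a
  go a (acc rs) pa = no-least (a , pa , λ a' a'<a → go a' (rs a'<a))

Least-≤ : ∀ {ℓ} {P : ℕ → Set ℓ} {a m} → Least P a → P m → a ≤ m
Least-≤ (_ , below) pm = ≮⇒≥ λ m<a → below _ m<a pm

Complete : Class
Complete H = ∀ {u v} → u ≢ v → E H u v

complete-not-bounded : ¬ LFBounded Bipartite Complete
complete-not-bounded (f , bounded) =
  ¬¬-least (λ s → HasLocalInjCover Bipartite s (K n)) (starCover-local (K n)) λ (a , a-least) →
  ¬¬-least (λ s → HasLocalCover Bipartite s (K n)) (doubleCover-2-local (K n)) λ (b , b-least) →
  let a≤fb = proj₂ (bounded (K n) id a b a-least b-least)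
      b<3  = s≤s (Least-≤ b-least (doubleCover-2-local (K n)))
  in  no-injective-local-cover s
        (HasLocalInjCover-mono (≤-trans a≤fb (≤-sumFin 3 f b<3)) (proj₁ a-least))
  where
  s = sumFin 3 (f ∘ toℕ)
  n = suc (conflictBound s)

proposition24 : (∀ (s : ℕ) → Σ ℕ λ n → ¬ HasLocalInjCover Bipartite s (K n))
    × (∀ (n : ℕ) → HasLocalCover Bipartite 2 (K n))
    × Σ Class (λ 𝒢 → Monotone 𝒢 × BoundedChromatic 𝒢 × Σ Class (λ ℋ → ¬ LFBounded 𝒢 ℋ))
proposition24 =
  (λ s → suc (conflictBound s) , no-injective-local-cover s) ,
  (λ n → doubleCover-2-local (K n)) ,
  Bipartite , Colourable-monotone 2 , (2 , λ _ bipartite → bipartite) ,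
  Complete , complete-not-bounded
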